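{- Let $\mathcal{A}=(A,\mapsto)$ be a distribution confluent PARS and let $D_1,D_2\in\mathrm{Dist}(A)$ be terminal distributions. Then $D_1$ and $D_2$ are related by the reflexive-symmetric-transitive closure of $\twoheadrightarrow$ if and only if $D_1\approx D_2$.
   Context: For a set $A$, $\mathrm{Dist}(A)$ is the set of finite lists of pairs $(p,a)$ with $p\in\mathbb{R}^+$ and $a\in A$; $[\,]$ empty list, $::$ cons, $++$ concatenation; $\mathrm{Dist}_1(A)$ the lists whose weights sum to $1$; $\alpha[(p_i,a_i)]_i=[(\alpha p_i,a_i)]_i$. A PARS is a pair $(A,\mapsto)$ with $\mapsto\subseteq A\times\mathrm{Dist}_1(A)$. An element $a$ is terminal if there is no $E$ with $a\mapsto E$; a distribution is terminal if all its elements are terminal. The relation $\sim$ is the smallest relation on $\mathrm{Dist}(A)$ containing $[(p,a),(q,b)]\sim[(q,b),(p,a)]$, $[(p,a),(q,a)]\sim[(p+q,a)]$, $[(p+q,a)]\sim[(p,a),(q,a)]$ and closed under $D\sim D'\Rightarrow E_1++D++E_2\sim E_1++D'++E_2$; $\approx$ is its reflexive-transitive closure. Parallel evolution $\to_P$: $[\,]\to_P[\,]$; if $ds\to_P ds'$ then $(p,a)::ds\to_P(p,a)::ds'$; if $a\mapsto E$ and $ds\to_P ds'$ then $(p,a)::ds\to_P pE++ds'$. Let $\twoheadrightarrow\;=\;\to_P\cup\approx$. $\mathcal{A}$ is distribution confluent if whenever $D\twoheadrightarrow^*E$ and $D\twoheadrightarrow^*F$ there is $C$ with $E\twoheadrightarrow^*C$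 and $F\twoheadrightarrow^*C$. -}

module Defs where

open import Data.List using (List; []; _∷_; _++_; map)
open import Data.List.Relation.Unary.All using (All)
open import Data.Product using (_×_; _,_; proj₂; Σ)
open import Data.Sum using (_⊎_)
open import Relation.Nullary using (¬_)
open import Relation.Binary.PropositionalEquality using (_≡_)
open import Relation.Binary.Construct.Closure.ReflexiveTransitive using (Star)

-- Abstract type of positive weights (ℝ⁺ in the paper): a carrier with
-- addition, multiplication and the unit 1.  No laws are assumed, so any
-- result proved here holds in particular for ℝ⁺.
record Weights : Set₁ where
  field
    W   : Set
    _+_ : W → W → W
    _*_ : W → W → W
    1#  : W

module _ (𝕎 : Weights) where
  open Weights 𝕎

  Dist : Set → Set
  Dist A = List (W × A)

  scale : {A : Set} → W → Dist A → Dist A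
  scale α D = map (λ { (p , a) → (α * p , a) }) D

  -- total weight of a nonempty list of weights (empty list has no
  -- positive total; it sums to 0 ≠ 1)
  data WeightSum {A : Set} : Dist A → W → Set where
    sum-one  : ∀ {p a} → WeightSum ((p , a) ∷ []) p
    sum-cons : ∀ {p a D s} → WeightSum D s → WeightSum ((p , a) ∷ D) (p + s)

  Dist₁ : {A : Set} → Dist A → Set
  Dist₁ D = WeightSum D 1#

  record PARS : Set₁ where
    field
      A     : Set
      _↦_   : A → Dist A → Set
      ↦-dist₁ : ∀ {a E} → a ↦ E → Dist₁ E

  module PARSDefs (𝒜 : PARS) where
    open PARS 𝒜

    Terminal : A → Set
    Terminal a = ∀ E → ¬ (a ↦ E)

    TerminalDist : Dist A → Set
    TerminalDist D = All (λ pa → Terminal (proj₂ pa)) D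

    infix 4 _∼_ _≈_ _→P_ _↠_ _↠*_
    data _∼_ : Dist A → Dist A → Set where
      swap  : ∀ {p a q b} → ((p , a) ∷ (q , b) ∷ []) ∼ ((q , b) ∷ (p , a) ∷ [])
      merge : ∀ {p q a} → ((p , a) ∷ (q , a) ∷ []) ∼ ((p + q , a) ∷ [])
      split : ∀ {p q a} → ((p + q , a) ∷ []) ∼ ((p , a) ∷ (q , a) ∷ [])
      ctx   : ∀ {D D'} (E₁ E₂ : Dist A) → D ∼ D' → (E₁ ++ D ++ E₂) ∼ (E₁ ++ D' ++ E₂)

    _≈_ : Dist A → Dist A → Set
    _≈_ = Star _∼_

    data _→P_ : Dist A → Dist A → Set where
      nil  : [] →P []
      keep : ∀ {p a ds ds'} → ds →P ds' → ((p , a) ∷ ds) →P ((p , a) ∷ ds')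
      step : ∀ {p a E ds ds'} → a ↦ E → ds →P ds' → ((p , a) ∷ ds) →P (scale p E ++ ds')

    _↠_ : Dist A → Dist A → Set
    D ↠ E = (D →P E) ⊎ (D ≈ E)

    _↠*_ : Dist A → Dist A → Set
    _↠*_ = Star _↠_

  DistConfluent : PARS → Set
  DistConfluent 𝒜 = ∀ {D E F} → D ↠* E → D ↠* F → Σ (Dist A) (λ C → (E ↠* C) × (F ↠* C))
    where open PARS 𝒜
          open PARSDefs 𝒜

-- Confluence turns a zig-zag of ↠-steps between D₁ and D₂ into a common
-- ↠*-reduct C. Out of a terminal distribution the only →P-step is the
-- identity, and ≈ preserves terminality, so every ↠*-path starting at a
-- terminal distribution is a ≈-path; hence D₁ ≈ C ≈ D₂.
module Submission where

open import Defs
open import Data.List.Relation.Unary.All using ([]; _∷_)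
open import Data.List.Relation.Unary.All.Properties using (++⁺; ++⁻)
open import Data.Product using (∃; _×_; _,_)
open import Data.Sum using (inj₁; inj₂)
open import Function.Bundles using (_⇔_; mk⇔)
open import Relation.Binary.Core using (Rel)
open import Relation.Binary.Construct.Closure.Equivalence using (EqClosure)
open import Relation.Binary.Construct.Closure.Symmetric using (fwd; bwd)
open import Relation.Binary.Construct.Closure.ReflexiveTransitive
  using (Star; ε; _◅_; _◅◅_; reverse)
open import Relation.Binary.PropositionalEquality using (_≡_; refl)
open import Relation.Binary.Rewriting using (Confluent)

module _ {a ℓ} {X : Set a} {_⟶_ : Rel X ℓ} where

  conf⇒eqClosure-joinable : Confluent _⟶_ → ∀ {x y} → EqClosure _⟶_ x y →
                            ∃ λ z → Star _⟶_ x z × Star _⟶_ y z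
  conf⇒eqClosure-joinable conf {x} ε = x , ε , ε
  conf⇒eqClosure-joinable conf (fwd x⟶w ◅ w↔y)
    with z , w↠z , y↠z ← conf⇒eqClosure-joinable conf w↔y
    = z , x⟶w ◅ w↠z , y↠z
  conf⇒eqClosure-joinable conf (bwd w⟶x ◅ w↔y)
    with z , w↠z , y↠z ← conf⇒eqClosure-joinable conf w↔y
    with z′ , x↠z′ , z↠z′ ← conf (w⟶x ◅ ε) w↠z
    = z′ , x↠z′ , y↠z ◅◅ z↠z′

module _ (𝕎 : Weights) (𝒜 : PARS 𝕎) where
  open PARSDefs 𝕎 𝒜

  ∼-sym : ∀ {D E} → D ∼ E → E ∼ D
  ∼-sym swap          = swap
  ∼-sym merge         = split
  ∼-sym split         = merge
  ∼-sym (ctx E₁ E₂ r) = ctx E₁ E₂ (∼-sym r)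

  ≈-sym : ∀ {D E} → D ≈ E → E ≈ D
  ≈-sym = reverse ∼-sym

  terminal-∼ : ∀ {D E} → D ∼ E → TerminalDist D → TerminalDist E
  terminal-∼ swap  (t₁ ∷ t₂ ∷ []) = t₂ ∷ t₁ ∷ []
  terminal-∼ merge (t  ∷ _  ∷ []) = t ∷ []
  terminal-∼ split (t  ∷ [])      = t ∷ t ∷ []
  terminal-∼ (ctx E₁ _ r) t
    with t₁ , t′ ← ++⁻ E₁ t
    with t₂ , t₃ ← ++⁻ _ t′
    = ++⁺ t₁ (++⁺ (terminal-∼ r t₂) t₃)

  terminal-≈ : ∀ {D E} → D ≈ E → TerminalDist D → TerminalDist E
  terminal-≈ ε        t = t
  terminal-≈ (r ◅ rs) t = terminal-≈ rs (terminal-∼ r t)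

  terminal-→P⇒≡ : ∀ {D E} → TerminalDist D → D →P E → E ≡ D
  terminal-→P⇒≡ []       nil        = refl
  terminal-→P⇒≡ (_ ∷ ts) (keep r)   with refl ← terminal-→P⇒≡ ts r = refl
  terminal-→P⇒≡ (t ∷ _)  (step s _) with () ← t _ s

  terminal-↠*⇒≈ : ∀ {D E} → TerminalDist D → D ↠* E → D ≈ E
  terminal-↠*⇒≈ t ε             = ε
  terminal-↠*⇒≈ t (inj₁ r ◅ rs) with refl ← terminal-→P⇒≡ t r = terminal-↠*⇒≈ t rs
  terminal-↠*⇒≈ t (inj₂ r ◅ rs) = r ◅◅ terminal-↠*⇒≈ (terminal-≈ r t) rs

lemma3p8 : (𝕎 : Weights) (𝒜 : PARS 𝕎) → DistConfluent 𝕎 𝒜 →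
           (D₁ D₂ : Dist 𝕎 (PARS.A 𝒜)) →
           PARSDefs.TerminalDist 𝕎 𝒜 D₁ → PARSDefs.TerminalDist 𝕎 𝒜 D₂ →
           (EqClosure (PARSDefs._↠_ 𝕎 𝒜) D₁ D₂ ⇔ PARSDefs._≈_ 𝕎 𝒜 D₁ D₂)
lemma3p8 𝕎 𝒜 conf D₁ D₂ t₁ t₂ = mk⇔ to from
  where
  open PARSDefs 𝕎 𝒜

  to : EqClosure _↠_ D₁ D₂ → D₁ ≈ D₂
  to D₁↔D₂ with _ , D₁↠C , D₂↠C ← conf⇒eqClosure-joinable conf D₁↔D₂
    = terminal-↠*⇒≈ 𝕎 𝒜 t₁ D₁↠C ◅◅ ≈-sym 𝕎 𝒜 (terminal-↠*⇒≈ 𝕎 𝒜 t₂ D₂↠C)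

  from : D₁ ≈ D₂ → EqClosure _↠_ D₁ D₂
  from D₁≈D₂ = fwd (inj₂ D₁≈D₂) ◅ ε
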